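{- Let $\Gamma$ be a connected faithful graph. Then $\mathrm{diam}(\Gamma)\le 2$.
   Context: All graphs are finite, simple and undirected with nonempty vertex set. $N_\Gamma[v]$ denotes the closed neighbourhood of a vertex $v$ ($v$ together with its neighbours). An edge $xy$ of $\Gamma$ is faithful if $N_\Gamma[x]\cup N_\Gamma[y] = V(\Gamma)$; $\Gamma$ is a faithful graph if every edge is faithful. The diameter of a connected graph is the maximum distance between two of its vertices. -}

module Defs where

open import Data.Nat using (ℕ; zero; suc; _≤_)
open import Data.Fin using (Fin)
open import Data.Product using (Σ; ∃; _×_; _,_)
open import Data.Sum using (_⊎_)
open import Relation.Nullary using (¬_; Dec)
open import Relation.Binary.PropositionalEquality using (_≡_)

record Graph (n : ℕ) : Set₁ where
  field
    Adj      : Fin n → Fin n → Set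
    adj?     : ∀ x y → Dec (Adj x y)
    sym      : ∀ {x y} → Adj x y → Adj y x
    irrefl   : ∀ {x} → ¬ Adj x x
open Graph public

module _ {n : ℕ} (G : Graph n) where

  InClosedNbhd : Fin n → Fin n → Set
  InClosedNbhd v w = (w ≡ v) ⊎ Adj G v w

  FaithfulEdge : Fin n → Fin n → Set
  FaithfulEdge x y = ∀ w → InClosedNbhd x w ⊎ InClosedNbhd y w

  IsFaithful : Set
  IsFaithful = ∀ x y → Adj G x y → FaithfulEdge x y

  data Walk : ℕ → Fin n → Fin n → Set where
    [] : ∀ {x} → Walk zero x x
    _∷_ : ∀ {k x y z} → Adj G x y → Walk k y z → Walk (suc k) x z

  DistLe : Fin n → Fin n → ℕ → Set
  DistLe x y k = Σ ℕ λ m → m ≤ k × Walk m x y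

  Connected : Set
  Connected = ∀ x y → Σ ℕ λ m → Walk m x y

  DiamLe : ℕ → Set
  DiamLe k = ∀ x y → DistLe x y k

{-# OPTIONS --safe #-}
module Submission where

open import Defs
open import Data.Nat using (ℕ; suc; zero; z≤n; s≤s)
open import Data.Nat.Properties using (m≤n⇒m≤1+n)
open import Data.Product using (_,_)
open import Data.Sum using (inj₁; inj₂)
open import Relation.Binary.PropositionalEquality using (refl)

module _ {n : ℕ} (G : Graph n) where

  distLe-refl : ∀ {x} k → DistLe G x x k
  distLe-refl k = zero , z≤n , []

  distLe-suc : ∀ {x y k} → DistLe G x y k → DistLe G x y (suc k)
  distLe-suc (m , m≤k , p) = m , m≤n⇒m≤1+n m≤k , p

  distLe-∷ : ∀ {x y z k} → Adj G x y → DistLe G y z k → DistLe G x z (suc k)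
  distLe-∷ e (m , m≤k , p) = suc m , s≤s m≤k , e ∷ p

  inClosedNbhd⇒distLe1 : ∀ {v w} → InClosedNbhd G v w → DistLe G v w 1
  inClosedNbhd⇒distLe1 (inj₁ refl) = distLe-refl 1
  inClosedNbhd⇒distLe1 (inj₂ e)    = distLe-∷ e (distLe-refl 0)

  faithfulEdge⇒distLe2 : ∀ {x a} → Adj G x a → FaithfulEdge G x a → ∀ w → DistLe G x w 2
  faithfulEdge⇒distLe2 e faithful w with faithful w
  ... | inj₁ w∈N[x] = distLe-suc (inClosedNbhd⇒distLe1 w∈N[x])
  ... | inj₂ w∈N[a] = distLe-∷ e (inClosedNbhd⇒distLe1 w∈N[a])

theorem3p6 : (n : ℕ) (G : Graph (suc n)) → Connected G → IsFaithful G → DiamLe G 2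
theorem3p6 n G connected faithful x y with connected x y
... | zero  , []    = distLe-refl G 2
... | suc _ , e ∷ _ = faithfulEdge⇒distLe2 G e (faithful _ _ e) y
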